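{- Fix integers $\ell\ge1$, $C\ge0$. For each $n$ let $D_1,\dots,D_\ell$ be pairwise edge-disjoint subgraphs of $K_{2n}$ with $\Delta(D_m)\le C$, and write $d_m=|E(D_m)|$, $\mathbf d=(d_m)_{m=1}^\ell$. Then for every $\mathbf x\in\mathbb N^\ell$, \[\mu_{\mathbf x}=\frac{(\mathbf d-O(|\mathbf x|)\mathbf 1)^{\mathbf x}}{\mathbf x!},\] meaning: there is a constant $K$ depending only on $C$ such that for all $n$ and $\mathbf x$ one can write $\mu_{\mathbf x}=\frac{1}{\mathbf x!}\prod_{m=1}^\ell\prod_{k=1}^{x_m}(d_m-c_{m,k})$ for some reals $c_{m,k}$ with $|c_{m,k}|\le K|\mathbf x|$.
   Context: An $\mathbf x$-matching of $K_{2n}$ is a matching $M$ with $|\mathbf x|=\sum_m x_m$ edges such that $|E(M\cap D_m)|=x_m$ for each $m$; $\mu_{\mathbf x}$ is the number of $\mathbf x$-matchings. $\mathbf x!=\prod_m x_m!$. $\Delta$ is maximum degree. -}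

module Defs where

open import Data.Nat using (ℕ; zero; suc; _+_; _*_; _≤_; _<_; _<ᵇ_; _≡ᵇ_; _!)
open import Data.Fin using (Fin; toℕ; _≟_)
open import Data.Bool using (Bool; true; false; _∧_; _∨_; not)
open import Data.List using (List; []; _∷_; _++_; map; filter; length; concatMap; allFin)
open import Data.Product using (_×_; _,_)
open import Relation.Nullary.Decidable using (⌊_⌋)
open import Data.Rational using (ℚ; 1ℚ)
open import Data.Integer using (+_)
import Data.Rational as Q

bfilter : ∀ {A : Set} → (A → Bool) → List A → List A
bfilter p [] = []
bfilter p (a ∷ as) with p a
... | true = a ∷ bfilter p as
... | false = bfilter p as

-- Vertices of K_v are Fin v.  The edges of K_v are the pairs (i , j) with i < j,
-- listed (each exactly once) by 'edges v'.
edges : (v : ℕ) → List (Fin v × Fin v)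
edges v = concatMap (λ i → map (λ j → (i , j)) (bfilter (λ j → toℕ i <ᵇ toℕ j) (allFin v))) (allFin v)

-- A (spanning) subgraph of K_v is given by its edge indicator; only its values on
-- pairs (i , j) with i < j (i.e. on edges of K_v) are ever consulted.
Graph : ℕ → Set
Graph v = Fin v → Fin v → Bool

E : ∀ {v} → Graph v → List (Fin v × Fin v)
E {v} D = bfilter (λ { (i , j) → D i j }) (edges v)

numEdges : ∀ {v} → Graph v → ℕ
numEdges D = length (E D)

_=ᶠ_ : ∀ {v} → Fin v → Fin v → Bool
i =ᶠ j = ⌊ i ≟ j ⌋

deg : ∀ {v} → Graph v → Fin v → ℕ
deg D w = length (bfilter (λ { (i , j) → (w =ᶠ i) ∨ (w =ᶠ j) }) (E D))

MaxDeg≤ : ∀ {v} → Graph v → ℕ → Set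
MaxDeg≤ D C = ∀ w → deg D w ≤ C

PairwiseEdgeDisjoint : ∀ {v ℓ} → (Fin ℓ → Graph v) → Set
PairwiseEdgeDisjoint {v} {ℓ} D =
  ∀ (m m' : Fin ℓ) (i j : Fin v) → toℕ i < toℕ j → D m i j ≡ true → D m' i j ≡ true → m ≡ m'
  where open import Relation.Binary.PropositionalEquality using (_≡_)

sublists : ∀ {A : Set} → List A → List (List A)
sublists [] = [] ∷ []
sublists (a ∷ as) = let r = sublists as in r ++ map (a ∷_) r

vdisj : ∀ {v} → Fin v × Fin v → Fin v × Fin v → Bool
vdisj (a , b) (c , d) = not ((a =ᶠ c) ∨ (a =ᶠ d) ∨ (b =ᶠ c) ∨ (b =ᶠ d))

allB : ∀ {A : Set} → (A → Bool) → List A → Bool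
allB p [] = true
allB p (x ∷ xs) = p x ∧ allB p xs

isMatching : ∀ {v} → List (Fin v × Fin v) → Bool
isMatching [] = true
isMatching (e ∷ es) = allB (vdisj e) es ∧ isMatching es

sumF : (k : ℕ) → (Fin k → ℕ) → ℕ
sumF zero f = 0
sumF (suc k) f = f Fin.zero + sumF k (λ i → f (Fin.suc i))
  where import Data.Fin as Fin

prodF : (k : ℕ) → (Fin k → ℕ) → ℕ
prodF zero f = 1
prodF (suc k) f = f Fin.zero * prodF k (λ i → f (Fin.suc i))
  where import Data.Fin as Fin

prodQ : (k : ℕ) → (Fin k → ℚ) → ℚ
prodQ zero f = 1ℚ
prodQ (suc k) f = f Fin.zero Q.* prodQ k (λ i → f (Fin.suc i))
  where import Data.Fin as Fin

∣_∣ᵥ : ∀ {ℓ} → (Fin ℓ → ℕ) → ℕ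
∣_∣ᵥ {ℓ} x = sumF ℓ x

_!ᵥ : ∀ {ℓ} → (Fin ℓ → ℕ) → ℕ
_!ᵥ {ℓ} x = prodF ℓ (λ m → x m !)

isXMatching : ∀ {v ℓ} → (Fin ℓ → Graph v) → (Fin ℓ → ℕ) → List (Fin v × Fin v) → Bool
isXMatching {v} {ℓ} D x M =
  isMatching M ∧ (length M ≡ᵇ ∣ x ∣ᵥ)
  ∧ allB (λ m → length (bfilter (λ { (i , j) → D m i j }) M) ≡ᵇ x m) (allFin ℓ)

μ : ∀ {v ℓ} → (Fin ℓ → Graph v) → (Fin ℓ → ℕ) → ℕ
μ {v} D x = length (bfilter (isXMatching D x) (sublists (edges v)))

ℕ→ℚ : ℕ → ℚ
ℕ→ℚ n = (+ n) Q./ 1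

{-# OPTIONS --safe #-}
-- Fix a colour m and a vector y. Counting pairs (M , e) with M a (y + e_m)-matching and e ∈ M ∩ D_m in two
-- ways gives (y_m + 1) μ_{y+e_m} = Σ_M f_m(M), the sum over y-matchings M of the number f_m(M) of edges of D_m
-- vertex-disjoint from M. Each of the |y| edges of M meets at most 2C edges of D_m, so
-- μ_y (d_m - 2C|y|) ≤ Σ_M f_m(M) ≤ μ_y d_m, i.e. μ_{y+e_m} (y + e_m)! = μ_y y! (d_m - c) for some 0 ≤ c ≤ 2C|y|.
-- Growing x from 0 one coordinate at a time multiplies in one such factor per step, which gives the claim with K = 2C.
module Submission where

open import Defs

-- A separate block, so that the ℕ operations opened here are out of scope in the statement, whose _*_ is ℚ's.
module _ where

  open import Algebra.Bundles using (CommutativeMonoid)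
  open import Data.Bool as Bool using (Bool; true; false; _∧_; _∨_; not)
  open import Data.Bool.Properties
    using (T-≡; not-injective; ¬-not; ∧-identityʳ; ∧-zeroʳ; ∧-conicalˡ; ∧-conicalʳ; ∧-commutativeMonoid; ∨-commutativeMonoid)
  open import Data.Bool.Solver using (module ∨-∧-Solver)
  open import Data.Fin as Fin using (Fin; _≟_)
  import Data.Fin.Properties as FinP
  open import Data.Fin.Properties using (any?; all?; ¬∀⟶∃¬)
  import Data.Integer as ℤ
  import Data.Integer.Properties as ℤ
  open import Data.List using (List; []; _∷_; _++_; map; length; allFin)
  open import Data.List.Membership.Propositional using (_∈_)
  open import Data.List.Membership.Propositional.Properties using (∈-allFin)
  open import Data.List.Relation.Unary.All as All using (All; []; _∷_)
  import Data.List.Relation.Unary.All.Properties as All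
  open import Data.List.Relation.Unary.Any using (here; there)
  open import Data.Nat as ℕ using (ℕ; zero; suc; _+_; _*_; _∸_; _≤_; z≤n; s≤s; _≡ᵇ_)
  open import Data.Nat.Coprimality using (Coprime)
  open import Data.Nat.Divisibility using (∣1⇒≡1)
  import Data.Nat.Properties as ℕ
  open import Data.Nat.Solver using (module +-*-Solver)
  open import Data.Product using (∃; _×_; _,_; proj₁; proj₂)
  open import Data.Rational as ℚ using (ℚ; mkℚ; 0ℚ; 1ℚ; ∣_∣)
  import Data.Rational.Properties as ℚ
  import Data.Rational.Solver as ℚ
  open import Data.Sum using (_⊎_; inj₁; inj₂)
  open import Data.Vec.Functional using (updateAt)
  open import Data.Vec.Functional.Properties
    using (updateAt-updates; updateAt-minimal; updateAt-updateAt; updateAt-cong-local; updateAt-id; updateAt-commutes)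
  open import Function using (_∘_; Equivalence)
  open import Relation.Binary.PropositionalEquality
    using (_≡_; _≢_; refl; sym; trans; cong; cong₂; subst; subst₂; module ≡-Reasoning)
  import Relation.Binary.Reasoning.Setoid as ≈-Reasoning
  open import Relation.Nullary using (Dec; yes; no; contradiction)
  open import Relation.Nullary.Decidable using (isYes≗does; dec-true; dec-false)
  open import Algebra.Properties.CommutativeSemigroup ℕ.+-commutativeSemigroup
    using () renaming (interchange to +-interchange)
  open import Algebra.Properties.CommutativeSemigroup (CommutativeMonoid.commutativeSemigroup ∨-commutativeMonoid)
    using () renaming (x∙yz≈y∙xz to ∨-x∙yz≈y∙xz)
  open import Algebra.Properties.CommutativeSemigroup (CommutativeMonoid.commutativeSemigroup ∧-commutativeMonoid)
    using () renaming (interchange to ∧-interchange)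

  𝟙 : Bool → ℕ
  𝟙 true  = 1
  𝟙 false = 0

  sumBy : {A : Set} → (A → ℕ) → List A → ℕ
  sumBy w []       = 0
  sumBy w (a ∷ as) = w a + sumBy w as

  module _ {A : Set} where

    sumBy-++ : ∀ (w : A → ℕ) xs ys → sumBy w (xs ++ ys) ≡ sumBy w xs + sumBy w ys
    sumBy-++ w []       ys = refl
    sumBy-++ w (x ∷ xs) ys = trans (cong (w x +_) (sumBy-++ w xs ys)) (sym (ℕ.+-assoc (w x) _ _))

    sumBy-map : ∀ {B : Set} (w : B → ℕ) (f : A → B) xs → sumBy w (map f xs) ≡ sumBy (λ a → w (f a)) xs
    sumBy-map w f []       = refl
    sumBy-map w f (x ∷ xs) = cong (w (f x) +_) (sumBy-map w f xs)

    sumBy-cong-local : ∀ {w w' : A → ℕ} {xs} → All (λ a → w a ≡ w' a) xs → sumBy w xs ≡ sumBy w' xs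
    sumBy-cong-local []         = refl
    sumBy-cong-local (eq ∷ eqs) = cong₂ _+_ eq (sumBy-cong-local eqs)

    sumBy-cong : ∀ {w w' : A → ℕ} → (∀ a → w a ≡ w' a) → ∀ xs → sumBy w xs ≡ sumBy w' xs
    sumBy-cong eq xs = sumBy-cong-local {xs = xs} (All.tabulate (λ {a} _ → eq a))

    sumBy-const : ∀ k (xs : List A) → sumBy (λ _ → k) xs ≡ length xs * k
    sumBy-const k []       = refl
    sumBy-const k (x ∷ xs) = cong (k +_) (sumBy-const k xs)

    sumBy-zero-local : ∀ {w : A → ℕ} {xs} → All (λ a → w a ≡ 0) xs → sumBy w xs ≡ 0
    sumBy-zero-local {xs = xs} eqs = trans (sumBy-cong-local eqs) (trans (sumBy-const 0 xs) (ℕ.*-zeroʳ (length xs)))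

    sumBy-zero : ∀ {w : A → ℕ} → (∀ a → w a ≡ 0) → ∀ xs → sumBy w xs ≡ 0
    sumBy-zero eq xs = sumBy-zero-local {xs = xs} (All.tabulate (λ {a} _ → eq a))

    sumBy-+ : ∀ (w w' : A → ℕ) xs → sumBy (λ a → w a + w' a) xs ≡ sumBy w xs + sumBy w' xs
    sumBy-+ w w' []       = refl
    sumBy-+ w w' (x ∷ xs) = trans (cong (w x + w' x +_) (sumBy-+ w w' xs)) (+-interchange (w x) (w' x) _ _)

    sumBy-*ʳ : ∀ (w : A → ℕ) k xs → sumBy (λ a → w a * k) xs ≡ sumBy w xs * k
    sumBy-*ʳ w k []       = refl
    sumBy-*ʳ w k (x ∷ xs) = trans (cong (w x * k +_) (sumBy-*ʳ w k xs)) (sym (ℕ.*-distribʳ-+ k (w x) _))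

    sumBy-*ˡ : ∀ (w : A → ℕ) k xs → sumBy (λ a → k * w a) xs ≡ k * sumBy w xs
    sumBy-*ˡ w k xs = trans (sumBy-cong (λ a → ℕ.*-comm k (w a)) xs) (trans (sumBy-*ʳ w k xs) (ℕ.*-comm _ k))

    sumBy-mono-≤ : ∀ {w w' : A → ℕ} → (∀ a → w a ≤ w' a) → ∀ xs → sumBy w xs ≤ sumBy w' xs
    sumBy-mono-≤ le []       = z≤n
    sumBy-mono-≤ le (x ∷ xs) = ℕ.+-mono-≤ (le x) (sumBy-mono-≤ le xs)

    length-bfilter : ∀ (p : A → Bool) xs → length (bfilter p xs) ≡ sumBy (λ a → 𝟙 (p a)) xs
    length-bfilter p []       = refl
    length-bfilter p (x ∷ xs) with p x
    ... | true  = cong suc (length-bfilter p xs)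
    ... | false = length-bfilter p xs

    bfilter-holds : ∀ (p : A → Bool) xs → All (λ a → p a ≡ true) (bfilter p xs)
    bfilter-holds p []       = []
    bfilter-holds p (x ∷ xs) with p x in px
    ... | true  = px ∷ bfilter-holds p xs
    ... | false = bfilter-holds p xs

    length-bfilter-bfilter : ∀ (p q : A → Bool) xs →
                             length (bfilter q (bfilter p xs)) ≡ sumBy (λ a → 𝟙 (p a ∧ q a)) xs
    length-bfilter-bfilter p q []       = refl
    length-bfilter-bfilter p q (x ∷ xs) with p x
    ... | false = length-bfilter-bfilter p q xs
    ... | true with q x
    ...   | true  = cong suc (length-bfilter-bfilter p q xs)
    ...   | false = length-bfilter-bfilter p q xs

  module _ {A : Set} where

    sumBy-sublists-∷ : ∀ (w : List A → ℕ) a as →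
                       sumBy w (sublists (a ∷ as)) ≡ sumBy w (sublists as) + sumBy (λ S → w (a ∷ S)) (sublists as)
    sumBy-sublists-∷ w a as =
      trans (sumBy-++ w (sublists as) _) (cong (sumBy w (sublists as) +_) (sumBy-map w (a ∷_) (sublists as)))

    All-sublists : ∀ {P : A → Set} {xs} → All P xs → All (All P) (sublists xs)
    All-sublists []                 = [] ∷ []
    All-sublists {xs = x ∷ xs} (p ∷ ps) =
      All.++⁺ (All-sublists ps) (All.map⁺ (All.map (p ∷_) (All-sublists ps)))

  -- sumF, prodF and prodQ of Defs are all this right fold over Fin k, taken in three different monoids.
  module FinFold {c ℓ} (M : CommutativeMonoid c ℓ)
    (fold : ∀ k → (Fin k → CommutativeMonoid.Carrier M) → CommutativeMonoid.Carrier M)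
    (fold-zero : ∀ f → fold 0 f ≡ CommutativeMonoid.ε M)
    (fold-suc : ∀ k f → fold (suc k) f ≡ CommutativeMonoid._∙_ M (f Fin.zero) (fold k (f ∘ Fin.suc))) where

    open CommutativeMonoid M using (Carrier; _∙_; ε)

    open CommutativeMonoid M
      using (_≈_; setoid; reflexive; ∙-cong; identityˡ; comm; semigroup; commutativeSemigroup) renaming (refl to ≈-refl)
    open import Algebra.Properties.Semigroup semigroup using (x∙yz≈xy∙z)
    open import Algebra.Properties.CommutativeSemigroup commutativeSemigroup using (interchange; xy∙z≈xz∙y)
    open ≈-Reasoning setoid

    fold-cong : ∀ k {f g : Fin k → Carrier} → (∀ i → f i ≈ g i) → fold k f ≈ fold k g
    fold-cong zero    {f} {g} eq = reflexive (trans (fold-zero f) (sym (fold-zero g)))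
    fold-cong (suc k) {f} {g} eq = begin
      fold (suc k) f              ≡⟨ fold-suc k f ⟩
      f Fin.zero ∙ fold k (f ∘ Fin.suc) ≈⟨ ∙-cong (eq Fin.zero) (fold-cong k (eq ∘ Fin.suc)) ⟩
      g Fin.zero ∙ fold k (g ∘ Fin.suc) ≡⟨ fold-suc k g ⟨
      fold (suc k) g              ∎

    fold-ε : ∀ k → fold k (λ _ → ε) ≈ ε
    fold-ε zero    = reflexive (fold-zero _)
    fold-ε (suc k) = begin
      fold (suc k) (λ _ → ε) ≡⟨ fold-suc k _ ⟩
      ε ∙ fold k (λ _ → ε)   ≈⟨ ∙-cong ≈-refl (fold-ε k) ⟩
      ε ∙ ε                  ≈⟨ identityˡ ε ⟩
      ε                      ∎

    fold-distrib : ∀ k (f g : Fin k → Carrier) → fold k (λ i → f i ∙ g i) ≈ fold k f ∙ fold k g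
    fold-distrib zero    f g = begin
      fold 0 _     ≡⟨ fold-zero _ ⟩
      ε            ≈⟨ identityˡ ε ⟨
      ε ∙ ε        ≡⟨ cong₂ _∙_ (fold-zero f) (fold-zero g) ⟨
      fold 0 f ∙ fold 0 g ∎
    fold-distrib (suc k) f g = begin
      fold (suc k) (λ i → f i ∙ g i)
        ≡⟨ fold-suc k _ ⟩
      (f Fin.zero ∙ g Fin.zero) ∙ fold k (λ i → f (Fin.suc i) ∙ g (Fin.suc i))
        ≈⟨ ∙-cong ≈-refl (fold-distrib k (f ∘ Fin.suc) (g ∘ Fin.suc)) ⟩
      (f Fin.zero ∙ g Fin.zero) ∙ (fold k (f ∘ Fin.suc) ∙ fold k (g ∘ Fin.suc))
        ≈⟨ interchange _ _ _ _ ⟩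
      (f Fin.zero ∙ fold k (f ∘ Fin.suc)) ∙ (g Fin.zero ∙ fold k (g ∘ Fin.suc))
        ≡⟨ cong₂ _∙_ (fold-suc k f) (fold-suc k g) ⟨
      fold (suc k) f ∙ fold (suc k) g ∎

    fold-update : ∀ k (f g : Fin k → Carrier) i t → (∀ j → j ≢ i → g j ≈ f j) → g i ≈ f i ∙ t →
                  fold k g ≈ fold k f ∙ t
    fold-update (suc k) f g Fin.zero t same changed = begin
      fold (suc k) g                         ≡⟨ fold-suc k g ⟩
      g Fin.zero ∙ fold k (g ∘ Fin.suc)      ≈⟨ ∙-cong changed (fold-cong k (λ j → same (Fin.suc j) λ ())) ⟩
      (f Fin.zero ∙ t) ∙ fold k (f ∘ Fin.suc) ≈⟨ xy∙z≈xz∙y _ _ _ ⟩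
      (f Fin.zero ∙ fold k (f ∘ Fin.suc)) ∙ t ≡⟨ cong (_∙ t) (fold-suc k f) ⟨
      fold (suc k) f ∙ t                     ∎
    fold-update (suc k) f g (Fin.suc i) t same changed = begin
      fold (suc k) g                           ≡⟨ fold-suc k g ⟩
      g Fin.zero ∙ fold k (g ∘ Fin.suc)        ≈⟨ ∙-cong (same Fin.zero λ ()) (fold-update k (f ∘ Fin.suc) (g ∘ Fin.suc) i t
                                                           (λ j j≢i → same (Fin.suc j) (j≢i ∘ FinP.suc-injective)) changed) ⟩
      f Fin.zero ∙ (fold k (f ∘ Fin.suc) ∙ t)  ≈⟨ x∙yz≈xy∙z _ _ _ ⟩
      (f Fin.zero ∙ fold k (f ∘ Fin.suc)) ∙ t  ≡⟨ cong (_∙ t) (fold-suc k f) ⟨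
      fold (suc k) f ∙ t                       ∎

    fold-snoc : ∀ k (g : ℕ → Carrier) → fold (suc k) (g ∘ Fin.toℕ) ≈ fold k (g ∘ Fin.toℕ) ∙ g k
    fold-snoc zero    g = begin
      fold 1 (g ∘ Fin.toℕ)      ≡⟨ fold-suc 0 _ ⟩
      g 0 ∙ fold 0 _            ≈⟨ ∙-cong ≈-refl (reflexive (fold-zero _)) ⟩
      g 0 ∙ ε                   ≈⟨ comm _ _ ⟩
      ε ∙ g 0                   ≡⟨ cong (_∙ g 0) (fold-zero _) ⟨
      fold 0 (g ∘ Fin.toℕ) ∙ g 0 ∎
    fold-snoc (suc k) g = begin
      fold (suc (suc k)) (g ∘ Fin.toℕ)             ≡⟨ fold-suc (suc k) _ ⟩
      g 0 ∙ fold (suc k) (g ∘ suc ∘ Fin.toℕ)       ≈⟨ ∙-cong ≈-refl (fold-snoc k (g ∘ suc)) ⟩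
      g 0 ∙ (fold k (g ∘ suc ∘ Fin.toℕ) ∙ g (suc k)) ≈⟨ x∙yz≈xy∙z _ _ _ ⟩
      (g 0 ∙ fold k (g ∘ suc ∘ Fin.toℕ)) ∙ g (suc k) ≡⟨ cong (_∙ g (suc k)) (fold-suc k _) ⟨
      fold (suc k) (g ∘ Fin.toℕ) ∙ g (suc k)       ∎

  module SumF  = FinFold ℕ.+-0-commutativeMonoid sumF (λ _ → refl) (λ _ _ → refl)
  module ProdF = FinFold ℕ.*-1-commutativeMonoid prodF (λ _ → refl) (λ _ _ → refl)
  module ProdQ = FinFold ℚ.*-1-commutativeMonoid prodQ (λ _ → refl) (λ _ _ → refl)

  sumF-𝟙-≤1 : ∀ k (p : Fin k → Bool) → (∀ i j → p i ≡ true → p j ≡ true → i ≡ j) → sumF k (𝟙 ∘ p) ≤ 1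
  sumF-𝟙-≤1 zero    p unique = z≤n
  sumF-𝟙-≤1 (suc k) p unique with p Fin.zero in p0
  ... | false = sumF-𝟙-≤1 k (p ∘ Fin.suc) (λ i j pi pj → FinP.suc-injective (unique _ _ pi pj))
  ... | true  = ℕ.≤-reflexive (cong suc (trans (SumF.fold-cong k others-false) (SumF.fold-ε k)))
    where
    others-false : ∀ i → 𝟙 (p (Fin.suc i)) ≡ 0
    others-false i with p (Fin.suc i) in pi
    ... | false = refl
    ... | true with () ← unique _ _ p0 pi

  𝟙-∧ : ∀ a b → 𝟙 (a ∧ b) ≡ 𝟙 a * 𝟙 b
  𝟙-∧ true  b = sym (ℕ.+-identityʳ (𝟙 b))
  𝟙-∧ false b = refl

  𝟙-∨ : ∀ {a b} → a ∨ b ≡ true → 1 ≤ 𝟙 a + 𝟙 b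
  𝟙-∨ {true}  _  = s≤s z≤n
  𝟙-∨ {false} eq rewrite eq = s≤s z≤n

  𝟙≤1 : ∀ b → 𝟙 b ≤ 1
  𝟙≤1 true  = s≤s z≤n
  𝟙≤1 false = z≤n

  𝟙-∧-≤ˡ : ∀ a b → 𝟙 (a ∧ b) ≤ 𝟙 a
  𝟙-∧-≤ˡ true  b = 𝟙≤1 b
  𝟙-∧-≤ˡ false b = z≤n

  module _ {A : Set} where

    allB-cong : ∀ {f g : A → Bool} → (∀ a → f a ≡ g a) → ∀ xs → allB f xs ≡ allB g xs
    allB-cong eq []       = refl
    allB-cong eq (x ∷ xs) = cong₂ _∧_ (eq x) (allB-cong eq xs)

    allB-∧ : ∀ (f g : A → Bool) xs → allB (λ a → f a ∧ g a) xs ≡ allB f xs ∧ allB g xs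
    allB-∧ f g []       = refl
    allB-∧ f g (x ∷ xs) = trans (cong ((f x ∧ g x) ∧_) (allB-∧ f g xs)) (∧-interchange (f x) (g x) _ _)

    allB-true : ∀ (xs : List A) → allB (λ _ → true) xs ≡ true
    allB-true []       = refl
    allB-true (x ∷ xs) = allB-true xs

    allB⇒All : ∀ {f : A → Bool} {xs} → allB f xs ≡ true → All (λ a → f a ≡ true) xs
    allB⇒All {xs = []}     _  = []
    allB⇒All {f} {x ∷ xs} eq = ∧-conicalˡ (f x) _ eq ∷ allB⇒All (∧-conicalʳ (f x) _ eq)

    allB-∈-false : ∀ {f : A → Bool} {a xs} → a ∈ xs → f a ≡ false → allB f xs ≡ false
    allB-∈-false {f} {xs = _ ∷ xs} (here refl)  fa = cong (_∧ allB f xs) fa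
    allB-∈-false {f} {xs = x ∷ _}  (there a∈xs) fa = trans (cong (f x ∧_) (allB-∈-false a∈xs fa)) (∧-zeroʳ (f x))

  Edge : ℕ → Set
  Edge v = Fin v × Fin v

  module _ {v : ℕ} where

    compatible : Edge v → List (Edge v) → Bool
    compatible e S = allB (vdisj e) S

    avoiding : List (Edge v) → List (Edge v) → Bool
    avoiding B S = allB (λ s → compatible s B) S

    Ordered : Edge v → Set
    Ordered (i , j) = Fin.toℕ i ℕ.< Fin.toℕ j

    edges-ordered : All Ordered (edges v)
    edges-ordered = All.concat⁺ (All.map⁺ (All.universal (λ i → All.map⁺
      (All.map (λ {j} i<ᵇj → ℕ.<ᵇ⇒< (Fin.toℕ i) (Fin.toℕ j) (Equivalence.from T-≡ i<ᵇj)) (bfilter-holds _ (allFin v))))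
      (allFin v)))

    touches : Fin v → Edge v → Bool
    touches w (i , j) = (w =ᶠ i) ∨ (w =ᶠ j)

    =ᶠ-refl : ∀ (i : Fin v) → (i =ᶠ i) ≡ true
    =ᶠ-refl i = trans (isYes≗does (i ≟ i)) (dec-true (i ≟ i) refl)

    =ᶠ-sym : ∀ (i j : Fin v) → (i =ᶠ j) ≡ (j =ᶠ i)
    =ᶠ-sym i j with i ≟ j
    ... | yes i≡j = sym (trans (isYes≗does (j ≟ i)) (dec-true  (j ≟ i) (sym i≡j)))
    ... | no  i≢j = sym (trans (isYes≗does (j ≟ i)) (dec-false (j ≟ i) (i≢j ∘ sym)))

    vdisj-self : ∀ (e : Edge v) → vdisj e e ≡ false
    vdisj-self (i , j) rewrite =ᶠ-refl i = refl

    vdisj-sym : ∀ (e f : Edge v) → vdisj e f ≡ vdisj f e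
    vdisj-sym (a , b) (c , d)
      rewrite =ᶠ-sym c a | =ᶠ-sym c b | =ᶠ-sym d a | =ᶠ-sym d b =
      cong (λ x → not ((a =ᶠ c) ∨ x)) (∨-x∙yz≈y∙xz (a =ᶠ d) (b =ᶠ c) (b =ᶠ d))

    ¬vdisj⇒touches : ∀ (e f : Edge v) → vdisj e f ≡ false → touches (proj₁ f) e ∨ touches (proj₂ f) e ≡ true
    ¬vdisj⇒touches (a , b) (c , d) e∩f
      rewrite =ᶠ-sym c a | =ᶠ-sym c b | =ᶠ-sym d a | =ᶠ-sym d b =
      trans (solve 4 (λ p q r s → (p :+ r) :+ (q :+ s) := p :+ (q :+ (r :+ s))) refl
                     (a =ᶠ c) (a =ᶠ d) (b =ᶠ c) (b =ᶠ d))
            (not-injective e∩f)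
      where open ∨-∧-Solver

    𝟙-compatible-∷ : ∀ p e s S → 𝟙 (p ∧ compatible e S)
                   ≤ 𝟙 (p ∧ compatible e (s ∷ S)) + (𝟙 (p ∧ touches (proj₁ s) e) + 𝟙 (p ∧ touches (proj₂ s) e))
    𝟙-compatible-∷ false e s S = z≤n
    𝟙-compatible-∷ true  e s S with vdisj e s in e∥s
    ... | true  = ℕ.m≤m+n _ _
    ... | false = ℕ.≤-trans (𝟙≤1 (compatible e S))
                    (ℕ.≤-trans (𝟙-∨ {touches (proj₁ s) e} (¬vdisj⇒touches e s e∥s)) (ℕ.m≤n+m _ 0))

    degreeIn : (Edge v → Bool) → List (Edge v) → Fin v → ℕ
    degreeIn P L w = sumBy (λ e → 𝟙 (P e ∧ touches w e)) L

    count≤compatible+degrees : ∀ (P : Edge v → Bool) L S →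
      sumBy (λ e → 𝟙 (P e)) L ≤ sumBy (λ e → 𝟙 (P e ∧ compatible e S)) L
                                + sumBy (λ s → degreeIn P L (proj₁ s) + degreeIn P L (proj₂ s)) S
    count≤compatible+degrees P L [] = ℕ.≤-reflexive
      (trans (sumBy-cong (λ e → cong 𝟙 (sym (∧-identityʳ (P e)))) L) (sym (ℕ.+-identityʳ _)))
    count≤compatible+degrees P L (s ∷ S) = begin
      sumBy (λ e → 𝟙 (P e)) L                 ≤⟨ count≤compatible+degrees P L S ⟩
      compatibles S + ∑deg S                  ≤⟨ ℕ.+-monoˡ-≤ (∑deg S) compatibles-∷ ⟩
      compatibles (s ∷ S) + deg₂ s + ∑deg S    ≡⟨ ℕ.+-assoc (compatibles (s ∷ S)) (deg₂ s) (∑deg S) ⟩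
      compatibles (s ∷ S) + ∑deg (s ∷ S)       ∎
      where
      open ℕ.≤-Reasoning
      compatibles : List (Edge v) → ℕ
      compatibles S′ = sumBy (λ e → 𝟙 (P e ∧ compatible e S′)) L
      deg₂ : Edge v → ℕ
      deg₂ s = degreeIn P L (proj₁ s) + degreeIn P L (proj₂ s)
      ∑deg : List (Edge v) → ℕ
      ∑deg = sumBy deg₂
      compatibles-∷ : compatibles S ≤ compatibles (s ∷ S) + deg₂ s
      compatibles-∷ = ℕ.≤-trans (sumBy-mono-≤ (λ e → 𝟙-compatible-∷ (P e) e s S) L)
        (ℕ.≤-reflexive (trans (sumBy-+ _ _ L) (cong (compatibles (s ∷ S) +_) (sumBy-+ _ _ L))))

  -- Counting x-matchings

  module Matchings {v ℓ} (D : Fin ℓ → Graph v) (disjoint : PairwiseEdgeDisjoint D) where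

    inD : Fin ℓ → Edge v → Bool
    inD m (i , j) = D m i j

    inD-unique : ∀ {e} → Ordered e → ∀ {m m'} → inD m e ≡ true → inD m' e ≡ true → m ≡ m'
    inD-unique {i , j} i<j = disjoint _ _ i j i<j

    inD-other : ∀ {e} → Ordered e → ∀ {m₀} → inD m₀ e ≡ true → ∀ m → m ≢ m₀ → inD m e ≡ false
    inD-other {e} ordered e∈m₀ m m≢m₀ with inD m e in e∈m
    ... | true  = contradiction (inD-unique ordered e∈m e∈m₀) m≢m₀
    ... | false = refl

    count : Fin ℓ → List (Edge v) → ℕ
    count m S = length (bfilter (inD m) S)

    count-∷ : ∀ m a S → count m (a ∷ S) ≡ 𝟙 (inD m a) + count m S
    count-∷ m a S with inD m a
    ... | true  = refl
    ... | false = refl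

    ∑count≤length : ∀ S → All Ordered S → sumF ℓ (λ m → count m S) ≤ length S
    ∑count≤length []      _                = ℕ.≤-reflexive (SumF.fold-ε ℓ)
    ∑count≤length (s ∷ S) (ordered ∷ rest) = begin
      sumF ℓ (λ m → count m (s ∷ S))                         ≡⟨ SumF.fold-cong ℓ (λ m → count-∷ m s S) ⟩
      sumF ℓ (λ m → 𝟙 (inD m s) + count m S)                 ≡⟨ SumF.fold-distrib ℓ _ _ ⟩
      sumF ℓ (λ m → 𝟙 (inD m s)) + sumF ℓ (λ m → count m S) ≤⟨ ℕ.+-mono-≤ (sumF-𝟙-≤1 ℓ _ (λ _ _ → inD-unique ordered))
                                                                            (∑count≤length S rest) ⟩
      suc (length S)                                          ∎
      where open ℕ.≤-Reasoning

    isXMatching-∷ : ∀ y a S → isXMatching D y (a ∷ S) ≡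
      (compatible a S ∧ isMatching S) ∧ (suc (length S) ≡ᵇ ∣ y ∣ᵥ) ∧ allB (λ m → 𝟙 (inD m a) + count m S ≡ᵇ y m) (allFin ℓ)
    isXMatching-∷ y a S =
      cong (λ c → (compatible a S ∧ isMatching S) ∧ (suc (length S) ≡ᵇ ∣ y ∣ᵥ) ∧ c)
           (allB-cong (λ m → cong (_≡ᵇ y m) (count-∷ m a S)) (allFin ℓ))

    isXMatching-cong : ∀ {y y'} → (∀ m → y m ≡ y' m) → ∀ S → isXMatching D y S ≡ isXMatching D y' S
    isXMatching-cong y≗y' S =
      cong₂ (λ n c → isMatching S ∧ (length S ≡ᵇ n) ∧ c)
            (SumF.fold-cong ℓ y≗y') (allB-cong (λ m → cong (count m S ≡ᵇ_) (y≗y' m)) (allFin ℓ))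

    ≡ᵇ-true⇒≡ : ∀ {m n} → (m ≡ᵇ n) ≡ true → m ≡ n
    ≡ᵇ-true⇒≡ {m} {n} eq = ℕ.≡ᵇ⇒≡ m n (Equivalence.from T-≡ eq)

    isXMatching⇒ : ∀ y S → isXMatching D y S ≡ true → length S ≡ ∣ y ∣ᵥ × (∀ m → count m S ≡ y m)
    isXMatching⇒ y S xm = ≡ᵇ-true⇒≡ (∧-conicalˡ _ _ rest) , λ m → ≡ᵇ-true⇒≡ (All.lookup counts (∈-allFin m))
      where
      rest : (length S ≡ᵇ ∣ y ∣ᵥ) ∧ allB (λ m → count m S ≡ᵇ y m) (allFin ℓ) ≡ true
      rest = ∧-conicalʳ (isMatching S) _ xm
      counts : All (λ m → (count m S ≡ᵇ y m) ≡ true) (allFin ℓ)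
      counts = allB⇒All (∧-conicalʳ _ _ rest)

    incAt decAt : (Fin ℓ → ℕ) → Fin ℓ → Fin ℓ → ℕ
    incAt y m = updateAt y m suc
    decAt y m = updateAt y m ℕ.pred

    ∣incAt∣ : ∀ y m → ∣ incAt y m ∣ᵥ ≡ suc ∣ y ∣ᵥ
    ∣incAt∣ y m = trans (SumF.fold-update ℓ y (incAt y m) m 1 (λ j j≢m → updateAt-minimal j m y j≢m)
                                              (trans (updateAt-updates m y) (ℕ.+-comm 1 (y m))))
                        (ℕ.+-comm _ 1)

    incAt-decAt : ∀ y m {k} → y m ≡ suc k → ∀ j → incAt (decAt y m) m j ≡ y j
    incAt-decAt y m y[m]≡1+k j = trans (updateAt-updateAt m y j) (trans (updateAt-cong-local m y suc-pred j) (updateAt-id m y j))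
      where
      suc-pred : suc (ℕ.pred (y m)) ≡ y m
      suc-pred = trans (cong (suc ∘ ℕ.pred) y[m]≡1+k) (sym y[m]≡1+k)

    ∣decAt∣ : ∀ y m {k} → y m ≡ suc k → ∣ y ∣ᵥ ≡ suc ∣ decAt y m ∣ᵥ
    ∣decAt∣ y m y[m]≡1+k = trans (sym (SumF.fold-cong ℓ (incAt-decAt y m y[m]≡1+k))) (∣incAt∣ (decAt y m) m)

    decAt-incAt : ∀ y m j → decAt (incAt y m) m j ≡ y j
    decAt-incAt y m j = trans (updateAt-updateAt m y j) (updateAt-id m y j)

    beside : List (Edge v) → (Fin ℓ → ℕ) → List (Edge v) → Bool
    beside B y S = isXMatching D y S ∧ avoiding B S

    weighted : List (Edge v) → List (Edge v) → (Fin ℓ → ℕ) → (List (Edge v) → ℕ) → ℕ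
    weighted L B y g = sumBy (λ S → 𝟙 (beside B y S) * g S) (sublists L)

    countBeside : List (Edge v) → List (Edge v) → (Fin ℓ → ℕ) → ℕ
    countBeside L B y = weighted L B y (λ _ → 1)

    isFree : Fin ℓ → Edge v → List (Edge v) → List (Edge v) → Bool
    isFree m e B S = inD m e ∧ compatible e B ∧ compatible e S

    freeEdges : Fin ℓ → List (Edge v) → List (Edge v) → List (Edge v) → ℕ
    freeEdges m L B S = sumBy (λ e → 𝟙 (isFree m e B S)) L

    totalFree : Fin ℓ → List (Edge v) → List (Edge v) → (Fin ℓ → ℕ) → ℕ
    totalFree m L B y = weighted L B y (freeEdges m L B)

    avoiding-∷ : ∀ (a : Edge v) B S → avoiding (a ∷ B) S ≡ compatible a S ∧ avoiding B S
    avoiding-∷ a B S = trans (allB-∧ (λ s → vdisj s a) (λ s → compatible s B) S)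
                             (cong (_∧ avoiding B S) (allB-cong (λ s → vdisj-sym s a) S))

    beside-cong : ∀ B {y y'} → (∀ m → y m ≡ y' m) → ∀ S → beside B y S ≡ beside B y' S
    beside-cong B y≗y' S = cong (_∧ avoiding B S) (isXMatching-cong y≗y' S)

    beside-∷-incompatible : ∀ a B → compatible a B ≡ false → ∀ y S → beside B y (a ∷ S) ≡ false
    beside-∷-incompatible a B a∩B y S rewrite a∩B = ∧-zeroʳ (isXMatching D y (a ∷ S))

    beside-∷-unclassified : ∀ {a} → (∀ m → inD m a ≡ false) → ∀ B y S → All Ordered S → beside B y (a ∷ S) ≡ false
    beside-∷-unclassified {a} unclassified B y S ordered with beside B y (a ∷ S) in eq
    ... | false = refl
    ... | true  = contradiction (ℕ.≤-trans (ℕ.≤-reflexive ∣y∣≡∑count) (∑count≤length S ordered)) (ℕ.<-irrefl refl)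
      where
      size,counts : suc (length S) ≡ ∣ y ∣ᵥ × (∀ m → count m (a ∷ S) ≡ y m)
      size,counts = isXMatching⇒ y (a ∷ S) (∧-conicalˡ _ _ eq)
      ∣y∣≡∑count : suc (length S) ≡ sumF ℓ (λ m → count m S)
      ∣y∣≡∑count = trans (proj₁ size,counts) (SumF.fold-cong ℓ λ m →
        trans (sym (proj₂ size,counts m)) (trans (count-∷ m a S) (cong (λ b → 𝟙 b + count m S) (unclassified m))))

    beside-∷-zero : ∀ {a m₀} → inD m₀ a ≡ true → ∀ B y → y m₀ ≡ 0 → ∀ S → beside B y (a ∷ S) ≡ false
    beside-∷-zero {a} {m₀} a∈m₀ B y y[m₀]≡0 S = begin
      beside B y (a ∷ S)                                   ≡⟨ cong (_∧ avoiding B (a ∷ S)) (isXMatching-∷ y a S) ⟩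
      ((compatible a S ∧ isMatching S) ∧ (suc (length S) ≡ᵇ ∣ y ∣ᵥ) ∧ counts-match) ∧ avoiding B (a ∷ S)
        ≡⟨ cong (λ c → ((compatible a S ∧ isMatching S) ∧ (suc (length S) ≡ᵇ ∣ y ∣ᵥ) ∧ c) ∧ avoiding B (a ∷ S))
                (allB-∈-false (∈-allFin m₀) m₀-mismatch) ⟩
      ((compatible a S ∧ isMatching S) ∧ (suc (length S) ≡ᵇ ∣ y ∣ᵥ) ∧ false) ∧ avoiding B (a ∷ S)
        ≡⟨ solve 3 (λ c l w → (c :* (l :* con false)) :* w := con false) refl
                 (compatible a S ∧ isMatching S) (suc (length S) ≡ᵇ ∣ y ∣ᵥ) (avoiding B (a ∷ S)) ⟩
      false                                                ∎
      where
      open ≡-Reasoning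
      open ∨-∧-Solver
      counts-match : Bool
      counts-match = allB (λ m → 𝟙 (inD m a) + count m S ≡ᵇ y m) (allFin ℓ)
      m₀-mismatch : (𝟙 (inD m₀ a) + count m₀ S ≡ᵇ y m₀) ≡ false
      m₀-mismatch rewrite a∈m₀ | y[m₀]≡0 = refl

    beside-∷-suc : ∀ a → Ordered a → ∀ {m₀} → inD m₀ a ≡ true → ∀ B → compatible a B ≡ true →
                   ∀ y {k} → y m₀ ≡ suc k → ∀ S → beside B y (a ∷ S) ≡ beside (a ∷ B) (decAt y m₀) S
    beside-∷-suc a ordered {m₀} a∈m₀ B a∥B y {k} y[m₀]≡1+k S = begin
      beside B y (a ∷ S)
        ≡⟨ cong₂ _∧_ (isXMatching-∷ y a S) (cong (_∧ avoiding B S) a∥B) ⟩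
      ((compatible a S ∧ isMatching S) ∧ (suc (length S) ≡ᵇ ∣ y ∣ᵥ)
                                       ∧ allB (λ m → 𝟙 (inD m a) + count m S ≡ᵇ y m) (allFin ℓ))
        ∧ (true ∧ avoiding B S)
        ≡⟨ cong₂ (λ l c → ((compatible a S ∧ isMatching S) ∧ l ∧ c) ∧ avoiding B S)
                 (cong (suc (length S) ≡ᵇ_) (∣decAt∣ y m₀ y[m₀]≡1+k)) (allB-cong counts-shift (allFin ℓ)) ⟩
      ((compatible a S ∧ isMatching S) ∧ (length S ≡ᵇ ∣ y' ∣ᵥ) ∧ allB (λ m → count m S ≡ᵇ y' m) (allFin ℓ))
        ∧ avoiding B S
        ≡⟨ solve 5 (λ c m l k w → ((c :* m) :* (l :* k)) :* w := (m :* (l :* k)) :* (c :* w)) refl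
                 (compatible a S) (isMatching S) (length S ≡ᵇ ∣ y' ∣ᵥ) (allB (λ m → count m S ≡ᵇ y' m) (allFin ℓ))
                 (avoiding B S) ⟩
      isXMatching D y' S ∧ (compatible a S ∧ avoiding B S)
        ≡⟨ cong (isXMatching D y' S ∧_) (avoiding-∷ a B S) ⟨
      beside (a ∷ B) y' S ∎
      where
      open ≡-Reasoning
      open ∨-∧-Solver
      y' : Fin ℓ → ℕ
      y' = decAt y m₀
      counts-shift : ∀ m → (𝟙 (inD m a) + count m S ≡ᵇ y m) ≡ (count m S ≡ᵇ y' m)
      counts-shift m with m ≟ m₀
      ... | yes refl = begin
        (𝟙 (inD m a) + count m S ≡ᵇ y m) ≡⟨ cong (λ b → 𝟙 b + count m S ≡ᵇ y m) a∈m₀ ⟩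
        (1 + count m S ≡ᵇ y m)        ≡⟨ cong (λ n → 1 + count m S ≡ᵇ n) y[m₀]≡1+k ⟩
        (count m S ≡ᵇ k)              ≡⟨ cong (λ n → count m S ≡ᵇ ℕ.pred n) y[m₀]≡1+k ⟨
        (count m S ≡ᵇ ℕ.pred (y m))   ≡⟨ cong (count m S ≡ᵇ_) (updateAt-updates m y) ⟨
        (count m S ≡ᵇ y' m)           ∎
      ... | no  m≢m₀ rewrite inD-other ordered a∈m₀ m m≢m₀ = cong (count m S ≡ᵇ_) (sym (updateAt-minimal m m₀ y m≢m₀))

    freeEdges-∷-∷ : ∀ m a as B S → freeEdges m (a ∷ as) B (a ∷ S) ≡ freeEdges m as (a ∷ B) S
    freeEdges-∷-∷ m a as B S = cong₂ _+_ a-not-free (sumBy-cong reorder as)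
      where
      open ∨-∧-Solver
      a-not-free : 𝟙 (inD m a ∧ compatible a B ∧ (vdisj a a ∧ compatible a S)) ≡ 0
      a-not-free rewrite vdisj-self a =
        cong 𝟙 (solve 2 (λ i c → i :* (c :* con false) := con false) refl (inD m a) (compatible a B))
      reorder : ∀ e → 𝟙 (inD m e ∧ compatible e B ∧ (vdisj e a ∧ compatible e S))
                    ≡ 𝟙 (inD m e ∧ (vdisj e a ∧ compatible e B) ∧ compatible e S)
      reorder e = cong 𝟙 (solve 4 (λ i b d s → i :* (b :* (d :* s)) := i :* ((d :* b) :* s)) refl
                                  (inD m e) (compatible e B) (vdisj e a) (compatible e S))

    weighted-+ : ∀ L B y (g g' : List (Edge v) → ℕ) → weighted L B y (λ S → g S + g' S) ≡ weighted L B y g + weighted L B y g'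
    weighted-+ L B y g g' = trans (sumBy-cong (λ S → ℕ.*-distribˡ-+ (𝟙 (beside B y S)) (g S) (g' S)) (sublists L))
                                  (sumBy-+ _ _ (sublists L))

    weighted-free-head : ∀ m a as B → compatible a B ≡ true → ∀ y →
      weighted as B y (λ S → 𝟙 (isFree m a B S)) ≡ 𝟙 (inD m a) * countBeside as (a ∷ B) y
    weighted-free-head m a as B a∥B y = trans (sumBy-cong regroup (sublists as)) (sumBy-*ˡ _ (𝟙 (inD m a)) (sublists as))
      where
      open +-*-Solver
      regroup : ∀ S → 𝟙 (beside B y S) * 𝟙 (isFree m a B S)
                    ≡ 𝟙 (inD m a) * (𝟙 (beside (a ∷ B) y S) * 1)
      regroup S rewrite a∥B | avoiding-∷ a B S
                      | 𝟙-∧ (isXMatching D y S) (avoiding B S) | 𝟙-∧ (inD m a) (compatible a S)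
                      | 𝟙-∧ (isXMatching D y S) (compatible a S ∧ avoiding B S) | 𝟙-∧ (compatible a S) (avoiding B S) =
        solve 4 (λ x w i c → (x :* w) :* (i :* c) := i :* ((x :* (c :* w)) :* con 1)) refl
              (𝟙 (isXMatching D y S)) (𝟙 (avoiding B S)) (𝟙 (inD m a)) (𝟙 (compatible a S))

    countBeside-cong : ∀ L B {y y'} → (∀ m → y m ≡ y' m) → countBeside L B y ≡ countBeside L B y'
    countBeside-cong L B y≗y' = sumBy-cong (λ S → cong (λ b → 𝟙 b * 1) (beside-cong B y≗y' S)) (sublists L)

    weighted⁺ : Edge v → List (Edge v) → List (Edge v) → (Fin ℓ → ℕ) → (List (Edge v) → ℕ) → ℕ
    weighted⁺ a as B y g = sumBy (λ S → 𝟙 (beside B y (a ∷ S)) * g S) (sublists as)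

    weighted⁺-vanishes : ∀ a {as} B y → All Ordered as → (∀ S → All Ordered S → beside B y (a ∷ S) ≡ false) →
                         ∀ g → weighted⁺ a as B y g ≡ 0
    weighted⁺-vanishes a B y as-ord never g =
      sumBy-zero-local (All.map (λ {S} S-ord → cong (λ b → 𝟙 b * g S) (never S S-ord)) (All-sublists as-ord))

    weighted⁺-shift : ∀ a as B y B' y' → (∀ S → beside B y (a ∷ S) ≡ beside B' y' S) →
                      ∀ g → weighted⁺ a as B y g ≡ weighted as B' y' g
    weighted⁺-shift a as B y B' y' shift g = sumBy-cong (λ S → cong (λ b → 𝟙 b * g S) (shift S)) (sublists as)

    module HeadEdge (m : Fin ℓ) (a : Edge v) (as : List (Edge v)) (a-ord : Ordered a) (as-ord : All Ordered as)
      (IH : ∀ B y → suc (y m) * countBeside as B (incAt y m) ≡ totalFree m as B y) (B : List (Edge v)) (y : Fin ℓ → ℕ) where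

      free-head : List (Edge v) → ℕ
      free-head S = 𝟙 (isFree m a B S)

      HeadIdentity : Set
      HeadIdentity = suc (y m) * weighted⁺ a as B (incAt y m) (λ _ → 1)
            ≡ weighted as B y free-head + weighted⁺ a as B y (freeEdges m as (a ∷ B))

      vanishing : (∀ S → All Ordered S → beside B (incAt y m) (a ∷ S) ≡ false) →
                  (∀ S → All Ordered S → beside B y (a ∷ S) ≡ false) → weighted as B y free-head ≡ 0 → HeadIdentity
      vanishing never-inc never no-head = begin
        suc (y m) * weighted⁺ a as B (incAt y m) _ ≡⟨ cong (suc (y m) *_) (weighted⁺-vanishes a B (incAt y m) as-ord never-inc _) ⟩
        suc (y m) * 0                              ≡⟨ ℕ.*-zeroʳ (suc (y m)) ⟩
        0                                          ≡⟨ cong₂ _+_ no-head (weighted⁺-vanishes a B y as-ord never _) ⟨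
        weighted as B y free-head + weighted⁺ a as B y (freeEdges m as (a ∷ B)) ∎
        where open ≡-Reasoning

      incompatible : compatible a B ≡ false → HeadIdentity
      incompatible a∩B = vanishing (λ S _ → beside-∷-incompatible a B a∩B _ S) (λ S _ → beside-∷-incompatible a B a∩B y S)
        (sumBy-zero (λ S → trans (cong (λ b → 𝟙 (beside B y S) * 𝟙 (inD m a ∧ b ∧ compatible a S)) a∩B)
                          (trans (cong (λ b → 𝟙 (beside B y S) * 𝟙 b) (∧-zeroʳ (inD m a)))
                                 (ℕ.*-zeroʳ (𝟙 (beside B y S))))) (sublists as))

      unclassified : (∀ m₀ → inD m₀ a ≡ false) → HeadIdentity
      unclassified none = vanishing (beside-∷-unclassified none B _) (beside-∷-unclassified none B y)
        (sumBy-zero (λ S → trans (cong (λ b → 𝟙 (beside B y S) * 𝟙 (b ∧ compatible a B ∧ compatible a S)) (none m))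
                                 (ℕ.*-zeroʳ (𝟙 (beside B y S)))) (sublists as))

      module Same (a∈m : inD m a ≡ true) (a∥B : compatible a B ≡ true) where

        N : ℕ
        N = countBeside as (a ∷ B) y

        head-term : weighted as B y free-head ≡ N
        head-term = trans (weighted-free-head m a as B a∥B y) (trans (cong (λ b → 𝟙 b * N) a∈m) (ℕ.+-identityʳ N))

        through-a : weighted⁺ a as B (incAt y m) (λ _ → 1) ≡ N
        through-a = trans
          (weighted⁺-shift a as B (incAt y m) (a ∷ B) (decAt (incAt y m) m)
                           (beside-∷-suc a a-ord a∈m B a∥B (incAt y m) (updateAt-updates m y)) _)
          (countBeside-cong as (a ∷ B) (decAt-incAt y m))

        when-zero : y m ≡ 0 → HeadIdentity
        when-zero y[m]≡0 = begin
          suc (y m) * weighted⁺ a as B (incAt y m) _   ≡⟨ cong₂ (λ k w → suc k * w) y[m]≡0 through-a ⟩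
          1 * N                                        ≡⟨ ℕ.*-identityˡ N ⟩
          N                                            ≡⟨ ℕ.+-identityʳ N ⟨
          N + 0                                        ≡⟨ cong₂ _+_ head-term (weighted⁺-vanishes a B y as-ord
                                                            (λ S _ → beside-∷-zero a∈m B y y[m]≡0 S) _) ⟨
          weighted as B y free-head + weighted⁺ a as B y (freeEdges m as (a ∷ B)) ∎
          where open ≡-Reasoning

        when-suc : ∀ {k} → y m ≡ suc k → HeadIdentity
        when-suc {k} y[m]≡1+k = begin
          suc (y m) * weighted⁺ a as B (incAt y m) _   ≡⟨ cong₂ (λ k w → suc k * w) y[m]≡1+k through-a ⟩
          N + suc k * N                                ≡⟨ cong₂ (λ k c → N + suc k * c) y'[m]≡k
                                                                (countBeside-cong as (a ∷ B) (incAt-decAt y m y[m]≡1+k)) ⟨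
          N + suc (y' m) * countBeside as (a ∷ B) (incAt y' m) ≡⟨ cong₂ _+_ head-term (sym (IH (a ∷ B) y')) ⟨
          weighted as B y free-head + totalFree m as (a ∷ B) y'
            ≡⟨ cong (weighted as B y free-head +_)
                    (weighted⁺-shift a as B y (a ∷ B) y' (beside-∷-suc a a-ord a∈m B a∥B y y[m]≡1+k) _) ⟨
          weighted as B y free-head + weighted⁺ a as B y (freeEdges m as (a ∷ B)) ∎
          where
          open ≡-Reasoning
          y' : Fin ℓ → ℕ
          y' = decAt y m
          y'[m]≡k : y' m ≡ k
          y'[m]≡k = trans (updateAt-updates m y) (cong ℕ.pred y[m]≡1+k)

      module Other {m₀} (a∈m₀ : inD m₀ a ≡ true) (m₀≢m : m₀ ≢ m) (a∥B : compatible a B ≡ true) where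

        head-term : weighted as B y free-head ≡ 0
        head-term = trans (weighted-free-head m a as B a∥B y)
                          (cong (λ b → 𝟙 b * countBeside as (a ∷ B) y) (inD-other a-ord a∈m₀ m (m₀≢m ∘ sym)))

        inc[m₀]≡y[m₀] : incAt y m m₀ ≡ y m₀
        inc[m₀]≡y[m₀] = updateAt-minimal m₀ m y m₀≢m

        when-zero : y m₀ ≡ 0 → HeadIdentity
        when-zero y[m₀]≡0 = vanishing (λ S _ → beside-∷-zero a∈m₀ B (incAt y m) (trans inc[m₀]≡y[m₀] y[m₀]≡0) S)
                                       (λ S _ → beside-∷-zero a∈m₀ B y y[m₀]≡0 S) head-term

        when-suc : ∀ {k} → y m₀ ≡ suc k → HeadIdentity
        when-suc y[m₀]≡1+k = begin
          suc (y m) * weighted⁺ a as B (incAt y m) _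
            ≡⟨ cong (suc (y m) *_) (weighted⁺-shift a as B (incAt y m) (a ∷ B) (decAt (incAt y m) m₀)
                  (beside-∷-suc a a-ord a∈m₀ B a∥B (incAt y m) (trans inc[m₀]≡y[m₀] y[m₀]≡1+k)) _) ⟩
          suc (y m) * countBeside as (a ∷ B) (decAt (incAt y m) m₀)
            ≡⟨ cong₂ (λ k c → suc k * c) (updateAt-minimal m m₀ y (m₀≢m ∘ sym))
                     (countBeside-cong as (a ∷ B) (updateAt-commutes m m₀ (m₀≢m ∘ sym) y)) ⟨
          suc (y' m) * countBeside as (a ∷ B) (incAt y' m)
            ≡⟨ IH (a ∷ B) y' ⟩
          totalFree m as (a ∷ B) y'
            ≡⟨ weighted⁺-shift a as B y (a ∷ B) y' (beside-∷-suc a a-ord a∈m₀ B a∥B y y[m₀]≡1+k) _ ⟨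
          weighted⁺ a as B y (freeEdges m as (a ∷ B))
            ≡⟨ cong (_+ weighted⁺ a as B y (freeEdges m as (a ∷ B))) head-term ⟨
          weighted as B y free-head + weighted⁺ a as B y (freeEdges m as (a ∷ B)) ∎
          where
          open ≡-Reasoning
          y' : Fin ℓ → ℕ
          y' = decAt y m₀

      head-identity : HeadIdentity
      head-identity = split (compatible a B) refl
        where
        by-value : ∀ n → (n ≡ 0 → HeadIdentity) → (∀ {k} → n ≡ suc k → HeadIdentity) → HeadIdentity
        by-value zero    z _ = z refl
        by-value (suc _) _ s = s refl
        split : ∀ b → compatible a B ≡ b → HeadIdentity
        split false a∩B = incompatible a∩B
        split true  a∥B with any? (λ m₀ → inD m₀ a Bool.≟ true)
        ... | no ¬classified = unclassified (λ m₀ → ¬-not (¬classified ∘ (m₀ ,_)))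
        ... | yes (m₀ , a∈m₀) with m₀ ≟ m
        ...   | yes refl = by-value (y m₀) (Same.when-zero a∈m₀ a∥B) (Same.when-suc a∈m₀ a∥B)
        ...   | no m₀≢m  = by-value (y m₀) (Other.when-zero a∈m₀ m₀≢m a∥B) (Other.when-suc a∈m₀ m₀≢m a∥B)

    -- Matchings inside L are counted beside a set B of edges they must avoid; moving the head edge of L into B
    -- when a matching uses it is what makes the induction on L go through.
    double-counting : ∀ m L → All Ordered L → ∀ B y → suc (y m) * countBeside L B (incAt y m) ≡ totalFree m L B y
    double-counting m [] _ B y = begin
      suc (y m) * (𝟙 (beside B (incAt y m) []) * 1 + 0) ≡⟨ cong (λ b → suc (y m) * (𝟙 b * 1 + 0)) no-empty-matching ⟩
      suc (y m) * 0                                      ≡⟨ ℕ.*-zeroʳ (suc (y m)) ⟩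
      0                                                  ≡⟨ cong (_+ 0) (ℕ.*-zeroʳ (𝟙 (beside B y []))) ⟨
      𝟙 (beside B y []) * 0 + 0                          ∎
      where
      open ≡-Reasoning
      no-empty-matching : beside B (incAt y m) [] ≡ false
      no-empty-matching rewrite ∣incAt∣ y m = refl
    double-counting m (a ∷ as) (a-ord ∷ as-ord) B y = begin
      s * countBeside (a ∷ as) B z
        ≡⟨ cong (s *_) (sumBy-sublists-∷ _ a as) ⟩
      s * (countBeside as B z + weighted⁺ a as B z (λ _ → 1))
        ≡⟨ ℕ.*-distribˡ-+ s (countBeside as B z) (weighted⁺ a as B z (λ _ → 1)) ⟩
      s * countBeside as B z + s * weighted⁺ a as B z (λ _ → 1)
        ≡⟨ cong₂ _+_ (double-counting m as as-ord B y) (HeadEdge.head-identity m a as a-ord as-ord (double-counting m as as-ord) B y) ⟩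
      totalFree m as B y + (weighted as B y free-head + weighted⁺ a as B y (freeEdges m as (a ∷ B)))
        ≡⟨ solve 3 (λ t h w → t :+ (h :+ w) := (h :+ t) :+ w) refl
                 (totalFree m as B y) (weighted as B y free-head) (weighted⁺ a as B y (freeEdges m as (a ∷ B))) ⟩
      (weighted as B y free-head + totalFree m as B y) + weighted⁺ a as B y (freeEdges m as (a ∷ B))
        ≡⟨ cong₂ _+_ (weighted-+ as B y free-head (freeEdges m as B))
                     (sumBy-cong (λ S → cong (𝟙 (beside B y (a ∷ S)) *_) (freeEdges-∷-∷ m a as B S)) (sublists as)) ⟨
      weighted as B y (freeEdges m (a ∷ as) B) + weighted⁺ a as B y (freeEdges m (a ∷ as) B ∘ (a ∷_))
        ≡⟨ sumBy-sublists-∷ _ a as ⟨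
      totalFree m (a ∷ as) B y ∎
      where
      open ≡-Reasoning
      open +-*-Solver
      s : ℕ
      s = suc (y m)
      z : Fin ℓ → ℕ
      z = incAt y m
      free-head : List (Edge v) → ℕ
      free-head S = 𝟙 (isFree m a B S)

    μ≡countBeside : ∀ y → μ D y ≡ countBeside (edges v) [] y
    μ≡countBeside y = trans (length-bfilter (isXMatching D y) (sublists (edges v)))
      (sumBy-cong (λ S → sym (trans (ℕ.*-identityʳ _)
                                    (cong 𝟙 (trans (cong (isXMatching D y S ∧_) (allB-true S)) (∧-identityʳ _)))))
                  (sublists (edges v)))

    μ-cong : ∀ {y y'} → (∀ m → y m ≡ y' m) → μ D y ≡ μ D y'
    μ-cong {y} {y'} y≗y' = trans (μ≡countBeside y) (trans (countBeside-cong (edges v) [] y≗y') (sym (μ≡countBeside y')))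

    0ᵥ : Fin ℓ → ℕ
    0ᵥ _ = 0

    μ-zero : μ D 0ᵥ ≡ 1
    μ-zero = trans (length-bfilter (isXMatching D 0ᵥ) (sublists (edges v))) (only-empty (edges v))
      where
      only-empty : ∀ L → sumBy (λ S → 𝟙 (isXMatching D 0ᵥ S)) (sublists L) ≡ 1
      only-empty [] rewrite SumF.fold-ε ℓ | allB-true (allFin ℓ) = refl
      only-empty (a ∷ L) = begin
        sumBy (λ S → 𝟙 (isXMatching D 0ᵥ S)) (sublists (a ∷ L))
          ≡⟨ sumBy-sublists-∷ _ a L ⟩
        sumBy (λ S → 𝟙 (isXMatching D 0ᵥ S)) (sublists L) + sumBy (λ S → 𝟙 (isXMatching D 0ᵥ (a ∷ S))) (sublists L)
          ≡⟨ cong₂ _+_ (only-empty L) (sumBy-zero (λ S → cong 𝟙 (nonempty S)) (sublists L)) ⟩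
        1 ∎
        where
        open ≡-Reasoning
        nonempty : ∀ S → isXMatching D 0ᵥ (a ∷ S) ≡ false
        nonempty S rewrite SumF.fold-ε ℓ = ∧-zeroʳ (compatible a S ∧ isMatching S)

    freeEdges≤numEdges : ∀ m S → freeEdges m (edges v) [] S ≤ numEdges (D m)
    freeEdges≤numEdges m S = ℕ.≤-trans (sumBy-mono-≤ (λ e → 𝟙-∧-≤ˡ (inD m e) (compatible e S)) (edges v))
                                       (ℕ.≤-reflexive (sym (length-bfilter (inD m) (edges v))))

    totalFree≤ : ∀ m y → totalFree m (edges v) [] y ≤ μ D y * numEdges (D m)
    totalFree≤ m y = begin
      totalFree m (edges v) [] y                                           ≤⟨ sumBy-mono-≤ pointwise (sublists (edges v)) ⟩
      sumBy (λ S → 𝟙 (beside [] y S) * 1 * numEdges (D m)) (sublists (edges v)) ≡⟨ sumBy-*ʳ _ (numEdges (D m)) (sublists (edges v)) ⟩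
      countBeside (edges v) [] y * numEdges (D m)                          ≡⟨ cong (_* numEdges (D m)) (μ≡countBeside y) ⟨
      μ D y * numEdges (D m)                                               ∎
      where
      open ℕ.≤-Reasoning
      pointwise : ∀ S → 𝟙 (beside [] y S) * freeEdges m (edges v) [] S ≤ 𝟙 (beside [] y S) * 1 * numEdges (D m)
      pointwise S = ℕ.≤-trans (ℕ.*-monoʳ-≤ (𝟙 (beside [] y S)) (freeEdges≤numEdges m S))
                              (ℕ.≤-reflexive (cong (_* numEdges (D m)) (sym (ℕ.*-identityʳ (𝟙 (beside [] y S))))))

    module _ (C : ℕ) (maxDeg : ∀ m → MaxDeg≤ (D m) C) where

      numEdges≤freeEdges+ : ∀ m S → numEdges (D m) ≤ freeEdges m (edges v) [] S + length S * (C + C)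
      numEdges≤freeEdges+ m S = begin
        numEdges (D m)                                      ≡⟨ length-bfilter (inD m) (edges v) ⟩
        sumBy (λ e → 𝟙 (inD m e)) (edges v)                 ≤⟨ count≤compatible+degrees (inD m) (edges v) S ⟩
        freeEdges m (edges v) [] S + sumBy (λ s → deg′ (proj₁ s) + deg′ (proj₂ s)) S
          ≤⟨ ℕ.+-monoʳ-≤ (freeEdges m (edges v) [] S)
                         (sumBy-mono-≤ (λ s → ℕ.+-mono-≤ (deg′≤C (proj₁ s)) (deg′≤C (proj₂ s))) S) ⟩
        freeEdges m (edges v) [] S + sumBy (λ _ → C + C) S  ≡⟨ cong (freeEdges m (edges v) [] S +_) (sumBy-const (C + C) S) ⟩
        freeEdges m (edges v) [] S + length S * (C + C)     ∎
        where
        open ℕ.≤-Reasoning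
        deg′ : Fin v → ℕ
        deg′ = degreeIn (inD m) (edges v)
        deg′≤C : ∀ w → deg′ w ≤ C
        deg′≤C w = ℕ.≤-trans (ℕ.≤-reflexive (sym (length-bfilter-bfilter (inD m) (touches w) (edges v)))) (maxDeg m w)

      totalFree≥ : ∀ m y → μ D y * numEdges (D m) ≤ totalFree m (edges v) [] y + μ D y * ((C + C) * ∣ y ∣ᵥ)
      totalFree≥ m y = begin
        μ D y * numEdges (D m)
          ≡⟨ cong (_* numEdges (D m)) (μ≡countBeside y) ⟩
        countBeside (edges v) [] y * numEdges (D m)
          ≡⟨ sumBy-*ʳ (λ S → 𝟙 (beside [] y S) * 1) (numEdges (D m)) (sublists (edges v)) ⟨
        sumBy (λ S → 𝟙 (beside [] y S) * 1 * numEdges (D m)) (sublists (edges v))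
          ≤⟨ sumBy-mono-≤ pointwise (sublists (edges v)) ⟩
        sumBy (λ S → 𝟙 (beside [] y S) * freeEdges m (edges v) [] S + 𝟙 (beside [] y S) * 1 * slack) (sublists (edges v))
          ≡⟨ sumBy-+ _ _ (sublists (edges v)) ⟩
        totalFree m (edges v) [] y + sumBy (λ S → 𝟙 (beside [] y S) * 1 * slack) (sublists (edges v))
          ≡⟨ cong (totalFree m (edges v) [] y +_)
                  (trans (sumBy-*ʳ (λ S → 𝟙 (beside [] y S) * 1) slack (sublists (edges v)))
                         (cong (_* slack) (sym (μ≡countBeside y)))) ⟩
        totalFree m (edges v) [] y + μ D y * slack ∎
        where
        open ℕ.≤-Reasoning
        slack : ℕ
        slack = (C + C) * ∣ y ∣ᵥ
        pointwise : ∀ S → 𝟙 (beside [] y S) * 1 * numEdges (D m)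
                        ≤ 𝟙 (beside [] y S) * freeEdges m (edges v) [] S + 𝟙 (beside [] y S) * 1 * slack
        pointwise S with beside [] y S in matching
        ... | false = z≤n
        ... | true  = begin
          1 * 1 * numEdges (D m)                               ≡⟨ ℕ.*-identityˡ (numEdges (D m)) ⟩
          numEdges (D m)                                       ≤⟨ numEdges≤freeEdges+ m S ⟩
          freeEdges m (edges v) [] S + length S * (C + C)      ≡⟨ cong₂ _+_ (sym (ℕ.*-identityˡ _))
                                                                   (trans (cong (_* (C + C)) size) (ℕ.*-comm ∣ y ∣ᵥ (C + C))) ⟩
          1 * freeEdges m (edges v) [] S + slack                ≡⟨ cong (1 * freeEdges m (edges v) [] S +_) (sym (ℕ.*-identityˡ slack)) ⟩
          1 * freeEdges m (edges v) [] S + 1 * 1 * slack           ∎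
          where
          size : length S ≡ ∣ y ∣ᵥ
          size = proj₁ (isXMatching⇒ y S (∧-conicalˡ _ _ matching))

  coprime-1 : ∀ n → Coprime n 1
  coprime-1 n (_ , d∣1) = ∣1⇒≡1 d∣1

  ℕ→ℚ≡mkℚ : ∀ n → ℕ→ℚ n ≡ mkℚ (ℤ.+ n) 0 (coprime-1 n)
  ℕ→ℚ≡mkℚ n = ℚ.normalize-coprime (coprime-1 n)

  ℕ→ℚ-homo-+ : ∀ a b → ℕ→ℚ (a + b) ≡ ℕ→ℚ a ℚ.+ ℕ→ℚ b
  ℕ→ℚ-homo-+ a b rewrite ℕ→ℚ≡mkℚ a | ℕ→ℚ≡mkℚ b | ℕ→ℚ≡mkℚ (a + b) =
    sym (trans (cong (ℚ._/ 1) (trans (cong₂ ℤ._+_ (ℤ.*-identityʳ (ℤ.+ a)) (ℤ.*-identityʳ (ℤ.+ b))) (sym (ℤ.pos-+ a b))))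
               (ℚ.normalize-coprime (coprime-1 _)))

  ℕ→ℚ-homo-* : ∀ a b → ℕ→ℚ (a * b) ≡ ℕ→ℚ a ℚ.* ℕ→ℚ b
  ℕ→ℚ-homo-* a b rewrite ℕ→ℚ≡mkℚ a | ℕ→ℚ≡mkℚ b | ℕ→ℚ≡mkℚ (a * b) =
    sym (trans (cong (ℚ._/ 1) (ℤ.+◃n≡+n (a * b))) (ℚ.normalize-coprime (coprime-1 _)))

  ℕ→ℚ-mono-≤ : ∀ {a b} → a ≤ b → ℕ→ℚ a ℚ.≤ ℕ→ℚ b
  ℕ→ℚ-mono-≤ {a} {b} a≤b rewrite ℕ→ℚ≡mkℚ a | ℕ→ℚ≡mkℚ b =
    ℚ.*≤* (subst₂ ℤ._≤_ (sym (ℤ.*-identityʳ (ℤ.+ a))) (sym (ℤ.*-identityʳ (ℤ.+ b))) (ℤ.+≤+ a≤b))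

  1/suc : ℕ → ℚ
  1/suc n = ℚ.1/ mkℚ (ℤ.+ suc n) 0 (coprime-1 (suc n))

  *-1/suc : ∀ n x → ℕ→ℚ (suc n) ℚ.* (x ℚ.* 1/suc n) ≡ x
  *-1/suc n x = begin
    ℕ→ℚ (suc n) ℚ.* (x ℚ.* 1/suc n) ≡⟨ cong (ℚ._* (x ℚ.* 1/suc n)) (ℕ→ℚ≡mkℚ (suc n)) ⟩
    N ℚ.* (x ℚ.* ℚ.1/ N)            ≡⟨ solve 3 (λ N x I → N :* (x :* I) := x :* (N :* I)) refl N x (ℚ.1/ N) ⟩
    x ℚ.* (N ℚ.* ℚ.1/ N)            ≡⟨ cong (x ℚ.*_) (ℚ.*-inverseʳ N) ⟩
    x ℚ.* 1ℚ                        ≡⟨ ℚ.*-identityʳ x ⟩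
    x                               ∎
    where
    open ≡-Reasoning
    open ℚ.+-*-Solver
    N : ℚ
    N = mkℚ (ℤ.+ suc n) 0 (coprime-1 (suc n))

  -- The witness is c = (n d ∸ a) / n, or c = 0 when n = 0 (and then a = 0).
  a≤nd≤a+nE⇒a≡n[d-c] : ∀ n a d E → a ≤ n * d → n * d ≤ a + n * E →
               ∃ λ c → ∣ c ∣ ℚ.≤ ℕ→ℚ E × ℕ→ℚ a ≡ ℕ→ℚ n ℚ.* (ℕ→ℚ d ℚ.- c)
  a≤nd≤a+nE⇒a≡n[d-c] zero    a d E a≤0 _ rewrite ℕ.n≤0⇒n≡0 a≤0 =
    0ℚ , ℕ→ℚ-mono-≤ {0} {E} z≤n , sym (ℚ.*-zeroˡ (ℕ→ℚ d ℚ.- 0ℚ))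
  a≤nd≤a+nE⇒a≡n[d-c] (suc p) a d E a≤nd nd≤a+nE = c , ∣c∣≤E , a≡n[d-c]
    where
    n r : ℕ
    n = suc p
    r = n * d ∸ a
    c : ℚ
    c = ℕ→ℚ r ℚ.* 1/suc p
    r+a≡nd : r + a ≡ n * d
    r+a≡nd = ℕ.m∸n+n≡m a≤nd
    r≤nE : r ≤ n * E
    r≤nE = ℕ.m≤n+o⇒m∸n≤o (n * d) a nd≤a+nE
    0≤c : 0ℚ ℚ.≤ c
    0≤c = subst (ℚ._≤ c) (ℚ.*-zeroˡ (1/suc p)) (ℚ.*-monoʳ-≤-nonNeg (1/suc p) (ℕ→ℚ-mono-≤ {0} {r} z≤n))
    c≤E : c ℚ.≤ ℕ→ℚ E
    c≤E = begin
      ℕ→ℚ r ℚ.* 1/suc p                ≤⟨ ℚ.*-monoʳ-≤-nonNeg (1/suc p) (ℕ→ℚ-mono-≤ r≤nE) ⟩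
      ℕ→ℚ (n * E) ℚ.* 1/suc p          ≡⟨ cong (ℚ._* 1/suc p) (ℕ→ℚ-homo-* n E) ⟩
      ℕ→ℚ n ℚ.* ℕ→ℚ E ℚ.* 1/suc p      ≡⟨ ℚ.*-assoc (ℕ→ℚ n) (ℕ→ℚ E) (1/suc p) ⟩
      ℕ→ℚ n ℚ.* (ℕ→ℚ E ℚ.* 1/suc p)    ≡⟨ *-1/suc p (ℕ→ℚ E) ⟩
      ℕ→ℚ E                            ∎
      where open ℚ.≤-Reasoning
    ∣c∣≤E : ∣ c ∣ ℚ.≤ ℕ→ℚ E
    ∣c∣≤E = subst (ℚ._≤ ℕ→ℚ E) (sym (ℚ.0≤p⇒∣p∣≡p 0≤c)) c≤E
    a≡n[d-c] : ℕ→ℚ a ≡ ℕ→ℚ n ℚ.* (ℕ→ℚ d ℚ.- c)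
    a≡n[d-c] = sym (begin
      ℕ→ℚ n ℚ.* (ℕ→ℚ d ℚ.- c)
        ≡⟨ solve 3 (λ n d c → n :* (d :- c) := n :* d :- n :* c) refl (ℕ→ℚ n) (ℕ→ℚ d) c ⟩
      ℕ→ℚ n ℚ.* ℕ→ℚ d ℚ.- ℕ→ℚ n ℚ.* c
        ≡⟨ cong₂ ℚ._-_ (sym (ℕ→ℚ-homo-* n d)) (*-1/suc p (ℕ→ℚ r)) ⟩
      ℕ→ℚ (n * d) ℚ.- ℕ→ℚ r
        ≡⟨ cong (λ q → ℕ→ℚ q ℚ.- ℕ→ℚ r) (sym r+a≡nd) ⟩
      ℕ→ℚ (r + a) ℚ.- ℕ→ℚ r
        ≡⟨ cong (ℚ._- ℕ→ℚ r) (ℕ→ℚ-homo-+ r a) ⟩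
      ℕ→ℚ r ℚ.+ ℕ→ℚ a ℚ.- ℕ→ℚ r
        ≡⟨ solve 2 (λ r a → r :+ a :- r := a) refl (ℕ→ℚ r) (ℕ→ℚ a) ⟩
      ℕ→ℚ a ∎)
      where
      open ≡-Reasoning
      open ℚ.+-*-Solver

  ℕ→ℚ-scale-step : ∀ μ μ⁺ f s (P t : ℚ) → ℕ→ℚ (s * μ⁺) ≡ ℕ→ℚ μ ℚ.* t → ℕ→ℚ μ ℚ.* ℕ→ℚ f ≡ P →
                   ℕ→ℚ μ⁺ ℚ.* ℕ→ℚ (f * s) ≡ P ℚ.* t
  ℕ→ℚ-scale-step μ μ⁺ f s P t sμ⁺≡μt μf≡P = begin
    ℕ→ℚ μ⁺ ℚ.* ℕ→ℚ (f * s)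
      ≡⟨ cong (ℕ→ℚ μ⁺ ℚ.*_) (ℕ→ℚ-homo-* f s) ⟩
    ℕ→ℚ μ⁺ ℚ.* (ℕ→ℚ f ℚ.* ℕ→ℚ s)
      ≡⟨ solve 3 (λ μ f s → μ :* (f :* s) := (s :* μ) :* f) refl (ℕ→ℚ μ⁺) (ℕ→ℚ f) (ℕ→ℚ s) ⟩
    ℕ→ℚ s ℚ.* ℕ→ℚ μ⁺ ℚ.* ℕ→ℚ f
      ≡⟨ cong (ℚ._* ℕ→ℚ f) (trans (sym (ℕ→ℚ-homo-* s μ⁺)) sμ⁺≡μt) ⟩
    ℕ→ℚ μ ℚ.* t ℚ.* ℕ→ℚ f
      ≡⟨ solve 3 (λ μ t f → (μ :* t) :* f := (μ :* f) :* t) refl (ℕ→ℚ μ) t (ℕ→ℚ f) ⟩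
    ℕ→ℚ μ ℚ.* ℕ→ℚ f ℚ.* t
      ≡⟨ cong (ℚ._* t) μf≡P ⟩
    P ℚ.* t ∎
    where
    open ≡-Reasoning
    open ℚ.+-*-Solver

  -- The product formula

  module ProductFormula {v ℓ} (D : Fin ℓ → Graph v) (disjoint : PairwiseEdgeDisjoint D)
                   (C : ℕ) (maxDeg : ∀ m → MaxDeg≤ (D m) C) where

    open Matchings D disjoint

    product-form : (Fin ℓ → ℕ → ℚ) → (Fin ℓ → ℕ) → ℚ
    product-form c y = prodQ ℓ (λ m → prodQ (y m) (λ k → ℕ→ℚ (numEdges (D m)) ℚ.- c m (Fin.toℕ k)))

    -- corrections m k is the c_{m,k+1} of the statement; indexing by ℕ lets a family be extended in place.
    -- A record rather than a Σ-type: unification would otherwise unfold the ℚ arithmetic in it, which is very slow.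
    record Expansion (y : Fin ℓ → ℕ) : Set where
      constructor mkExpansion
      field
        corrections : Fin ℓ → ℕ → ℚ
        bounded     : ∀ m k → ∣ corrections m k ∣ ℚ.≤ ℕ→ℚ ((C + C) * ∣ y ∣ᵥ)
        equation    : ℕ→ℚ (μ D y) ℚ.* ℕ→ℚ (y !ᵥ) ≡ product-form corrections y

    expansion-cong : ∀ {y y'} → (∀ m → y m ≡ y' m) → Expansion y → Expansion y'
    expansion-cong {y} {y'} y≗y' (mkExpansion c bounded μy!≡prod) = mkExpansion c bounded' equation
      where
      bounded' : ∀ m k → ∣ c m k ∣ ℚ.≤ ℕ→ℚ ((C + C) * ∣ y' ∣ᵥ)
      bounded' m k = subst (λ n → ∣ c m k ∣ ℚ.≤ ℕ→ℚ ((C + C) * n)) (SumF.fold-cong ℓ y≗y') (bounded m k)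
      equation : ℕ→ℚ (μ D y') ℚ.* ℕ→ℚ (y' !ᵥ) ≡ product-form c y'
      equation = begin
        ℕ→ℚ (μ D y') ℚ.* ℕ→ℚ (y' !ᵥ)
          ≡⟨ cong₂ (λ a b → ℕ→ℚ a ℚ.* ℕ→ℚ b) (μ-cong y≗y') (ProdF.fold-cong ℓ (cong ℕ._! ∘ y≗y')) ⟨
        ℕ→ℚ (μ D y) ℚ.* ℕ→ℚ (y !ᵥ)
          ≡⟨ μy!≡prod ⟩
        product-form c y
          ≡⟨ ProdQ.fold-cong ℓ (λ m → cong (λ n → prodQ n (λ k → ℕ→ℚ (numEdges (D m)) ℚ.- c m (Fin.toℕ k))) (y≗y' m)) ⟩
        product-form c y' ∎
        where open ≡-Reasoning

    expansion-zero : Expansion 0ᵥ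
    expansion-zero = mkExpansion (λ _ _ → 0ℚ) (λ _ _ → ℕ→ℚ-mono-≤ {0} {(C + C) * ∣ 0ᵥ ∣ᵥ} z≤n) (begin
      ℕ→ℚ (μ D 0ᵥ) ℚ.* ℕ→ℚ (0ᵥ !ᵥ) ≡⟨ cong₂ (λ a b → ℕ→ℚ a ℚ.* ℕ→ℚ b) μ-zero (ProdF.fold-ε ℓ) ⟩
      1ℚ ℚ.* 1ℚ                                  ≡⟨ ProdQ.fold-ε ℓ ⟨
      product-form (λ _ _ → 0ℚ) 0ᵥ               ∎)
      where open ≡-Reasoning

    _[_,_]≔_ : (Fin ℓ → ℕ → ℚ) → Fin ℓ → ℕ → ℚ → Fin ℓ → ℕ → ℚ
    (c [ m , j ]≔ q) m' k with m' ≟ m | k ℕ.≟ j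
    ... | yes _ | yes _ = q
    ... | _     | _     = c m' k

    ≔-hit : ∀ c m j q → (c [ m , j ]≔ q) m j ≡ q
    ≔-hit c m j q with m ≟ m | j ℕ.≟ j
    ... | yes _ | yes _   = refl
    ... | no m≢m | _      = contradiction refl m≢m
    ... | yes _ | no j≢j  = contradiction refl j≢j

    ≔-miss : ∀ c m j q m' k → m' ≢ m ⊎ k ≢ j → (c [ m , j ]≔ q) m' k ≡ c m' k
    ≔-miss c m j q m' k elsewhere with m' ≟ m | k ℕ.≟ j | elsewhere
    ... | yes m'≡m | yes _   | inj₁ m'≢m = contradiction m'≡m m'≢m
    ... | yes _    | yes k≡j | inj₂ k≢j  = contradiction k≡j k≢j
    ... | yes _    | no _    | _         = refl
    ... | no _     | _       | _         = refl

    ≔-preserves : ∀ (P : ℚ → Set) c m j q → P q → (∀ m' k → P (c m' k)) → ∀ m' k → P ((c [ m , j ]≔ q) m' k)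
    ≔-preserves P c m j q Pq Pc m' k with m' ≟ m | k ℕ.≟ j
    ... | yes _ | yes _ = Pq
    ... | yes _ | no _  = Pc m' k
    ... | no _  | _     = Pc m' k

    product-form-cong : ∀ c c' y → (∀ m (k : Fin (y m)) → c m (Fin.toℕ k) ≡ c' m (Fin.toℕ k)) →
                        product-form c y ≡ product-form c' y
    product-form-cong c c' y c≗c' =
      ProdQ.fold-cong ℓ λ m → ProdQ.fold-cong (y m) λ k → cong (λ q → ℕ→ℚ (numEdges (D m)) ℚ.- q) (c≗c' m k)

    product-form-incAt : ∀ c y m → product-form c (incAt y m) ≡ product-form c y ℚ.* (ℕ→ℚ (numEdges (D m)) ℚ.- c m (y m))
    product-form-incAt c y m = ProdQ.fold-update ℓ (λ m' → prodQ (y m') (factor m' ∘ Fin.toℕ))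
      (λ m' → prodQ (incAt y m m') (factor m' ∘ Fin.toℕ)) m (factor m (y m))
      (λ m' m'≢m → cong (λ n → prodQ n (factor m' ∘ Fin.toℕ)) (updateAt-minimal m' m y m'≢m))
      (trans (cong (λ n → prodQ n (factor m ∘ Fin.toℕ)) (updateAt-updates m y)) (ProdQ.fold-snoc (y m) (factor m)))
      where
      factor : Fin ℓ → ℕ → ℚ
      factor m' k = ℕ→ℚ (numEdges (D m')) ℚ.- c m' k

    ≔-below : ∀ c m (y : Fin ℓ → ℕ) q m' (k : Fin (y m')) → (c [ m , y m ]≔ q) m' (Fin.toℕ k) ≡ c m' (Fin.toℕ k)
    ≔-below c m y q m' k = ≔-miss c m (y m) q m' (Fin.toℕ k) (below (m' ≟ m))
      where
      below : Dec (m' ≡ m) → m' ≢ m ⊎ Fin.toℕ k ≢ y m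
      below (yes refl) = inj₂ (ℕ.<⇒≢ (FinP.toℕ<n {n = y m'} k))
      below (no m'≢m)  = inj₁ m'≢m

    expansion-step : ∀ y m → Expansion y → Expansion (incAt y m)
    expansion-step y m (mkExpansion c bounded μy!≡prod) =
      extend (a≤nd≤a+nE⇒a≡n[d-c] (μ D y) (suc (y m) * μ D (incAt y m)) (numEdges (D m)) ((C + C) * ∣ y ∣ᵥ) upper lower)
      where
      s*μ⁺≡totalFree : suc (y m) * μ D (incAt y m) ≡ totalFree m (edges v) [] y
      s*μ⁺≡totalFree = trans (cong (suc (y m) *_) (μ≡countBeside (incAt y m))) (double-counting m (edges v) edges-ordered [] y)

      upper : suc (y m) * μ D (incAt y m) ≤ μ D y * numEdges (D m)
      upper = subst (_≤ μ D y * numEdges (D m)) (sym s*μ⁺≡totalFree) (totalFree≤ m y)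

      lower : μ D y * numEdges (D m) ≤ suc (y m) * μ D (incAt y m) + μ D y * ((C + C) * ∣ y ∣ᵥ)
      lower = subst (λ a → μ D y * numEdges (D m) ≤ a + μ D y * ((C + C) * ∣ y ∣ᵥ)) (sym s*μ⁺≡totalFree)
                    (totalFree≥ C maxDeg m y)

      grow : ℕ→ℚ ((C + C) * ∣ y ∣ᵥ) ℚ.≤ ℕ→ℚ ((C + C) * ∣ incAt y m ∣ᵥ)
      grow = ℕ→ℚ-mono-≤ (ℕ.*-monoʳ-≤ (C + C) (ℕ.≤-trans (ℕ.n≤1+n _) (ℕ.≤-reflexive (sym (∣incAt∣ y m)))))

      factorial-step : incAt y m !ᵥ ≡ y !ᵥ * suc (y m)
      factorial-step = ProdF.fold-update ℓ (λ m' → y m' ℕ.!) (λ m' → incAt y m m' ℕ.!) m (suc (y m))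
        (λ m' m'≢m → cong ℕ._! (updateAt-minimal m' m y m'≢m))
        (trans (cong ℕ._! (updateAt-updates m y)) (ℕ.*-comm (suc (y m)) (y m ℕ.!)))

      extend : (∃ λ c₀ → ∣ c₀ ∣ ℚ.≤ ℕ→ℚ ((C + C) * ∣ y ∣ᵥ)
                        × ℕ→ℚ (suc (y m) * μ D (incAt y m)) ≡ ℕ→ℚ (μ D y) ℚ.* (ℕ→ℚ (numEdges (D m)) ℚ.- c₀))
               → Expansion (incAt y m)
      extend (c₀ , ∣c₀∣≤ , s*μ⁺≡μ[d-c₀]) = mkExpansion (c [ m , y m ]≔ c₀) bounded' equation
        where
        bounded' : ∀ m' k → ∣ (c [ m , y m ]≔ c₀) m' k ∣ ℚ.≤ ℕ→ℚ ((C + C) * ∣ incAt y m ∣ᵥ)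
        bounded' = ≔-preserves (λ q → ∣ q ∣ ℚ.≤ ℕ→ℚ ((C + C) * ∣ incAt y m ∣ᵥ)) c m (y m) c₀
          (ℚ.≤-trans ∣c₀∣≤ grow) (λ m' k → ℚ.≤-trans (bounded m' k) grow)

        unchanged : product-form (c [ m , y m ]≔ c₀) y ≡ product-form c y
        unchanged = product-form-cong (c [ m , y m ]≔ c₀) c y (≔-below c m y c₀)

        new-factor : product-form (c [ m , y m ]≔ c₀) (incAt y m)
                   ≡ product-form (c [ m , y m ]≔ c₀) y ℚ.* (ℕ→ℚ (numEdges (D m)) ℚ.- c₀)
        new-factor = trans (product-form-incAt (c [ m , y m ]≔ c₀) y m)
          (cong (λ q → product-form (c [ m , y m ]≔ c₀) y ℚ.* (ℕ→ℚ (numEdges (D m)) ℚ.- q)) (≔-hit c m (y m) c₀))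

        equation : ℕ→ℚ (μ D (incAt y m)) ℚ.* ℕ→ℚ (incAt y m !ᵥ) ≡ product-form (c [ m , y m ]≔ c₀) (incAt y m)
        equation = trans (cong (λ n → ℕ→ℚ (μ D (incAt y m)) ℚ.* ℕ→ℚ n) factorial-step)
          (trans (ℕ→ℚ-scale-step (μ D y) (μ D (incAt y m)) (y !ᵥ) (suc (y m))
                    (product-form (c [ m , y m ]≔ c₀) y) (ℕ→ℚ (numEdges (D m)) ℚ.- c₀)
                    s*μ⁺≡μ[d-c₀] (trans μy!≡prod (sym unchanged)))
                 (sym new-factor))

    expansion-of-size : ∀ n y → ∣ y ∣ᵥ ≡ n → Expansion y
    expansion-of-size n y ∣y∣≡n with all? (λ m → y m ℕ.≟ 0)
    ... | yes y≗0 = expansion-cong (λ m → sym (y≗0 m)) expansion-zero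
    ... | no ¬y≗0 with (m , y[m]≢0) ← ¬∀⟶∃¬ ℓ _ (λ m → y m ℕ.≟ 0) ¬y≗0
                     | n | sym (ℕ.suc-pred (y m) ⦃ ℕ.≢-nonZero y[m]≢0 ⦄)
    ...   | zero   | y[m]≡1+k = contradiction (trans (sym (∣decAt∣ y m y[m]≡1+k)) ∣y∣≡n) ℕ.1+n≢0
    ...   | suc n' | y[m]≡1+k = expansion-cong (incAt-decAt y m y[m]≡1+k) (expansion-step (decAt y m) m
      (expansion-of-size n' (decAt y m) (ℕ.suc-injective (trans (sym (∣decAt∣ y m y[m]≡1+k)) ∣y∣≡n))))

    expansion : ∀ y → Expansion y
    expansion y = expansion-of-size ∣ y ∣ᵥ y refl

open import Data.Nat using (ℕ; _≤_)
open import Data.Fin using (Fin)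
open import Data.Product using (Σ; ∃; _×_; _,_)
open import Relation.Binary.PropositionalEquality using (_≡_; refl)
open import Data.Rational using (ℚ; ∣_∣; _-_; _*_)
import Data.Rational as Q

lemma3p4 : (C : ℕ) → ∃ λ (K : ℕ) →
  (ℓ : ℕ) → 1 ≤ ℓ → (n : ℕ) → (D : Fin ℓ → Graph (2 Data.Nat.* n)) →
  PairwiseEdgeDisjoint D → (∀ m → MaxDeg≤ (D m) C) →
  (x : Fin ℓ → ℕ) →
  Σ ((m : Fin ℓ) → Fin (x m) → ℚ) λ c →
    (∀ m k → ∣ c m k ∣ Q.≤ ℕ→ℚ (K Data.Nat.* ∣ x ∣ᵥ))
    × (ℕ→ℚ (μ D x) * ℕ→ℚ (x !ᵥ)
         ≡ prodQ ℓ (λ m → prodQ (x m) (λ k → ℕ→ℚ (numEdges (D m)) - c m k)))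
lemma3p4 C = C Data.Nat.+ C , λ ℓ _ n D disjoint maxDeg x →
  let open ProductFormula D disjoint C maxDeg
      open Expansion (expansion x)
  in (λ m k → corrections m (Data.Fin.toℕ k)) , (λ m k → bounded m (Data.Fin.toℕ k)) , equation
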